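{- Let $P_n$ be the path on $n$ vertices. (1) If $n$ is even, then $\mathcal{TE}_-(P_n)=\mathcal{TS}_-(P_n)\cong K_1$. (2) If $n$ is odd, then $\mathcal{TE}_-(P_n)\cong K_{(n+1)/2}$ and $\mathcal{TS}_-(P_n)\cong \frac{n+1}{2}K_1$ (the graph with $\frac{n+1}{2}$ vertices and no edges).
   Context: Skew forcing on a graph $G$: vertices are blue or white; starting from an initial blue set $B$ (possibly empty), repeatedly apply: if any vertex $u$ (blue or white) has exactly one white neighbor $w$, then $w$ becomes blue. $B$ is a skew forcing set if eventually all vertices are blue; $\mathrm{Z}_-(G)$ is the minimum size of a skew forcing set. $\mathcal{TE}_-(G)$ has as vertices the skew forcing sets of size $\mathrm{Z}_-(G)$, with $S_1S_2$ an edge iff there are $v_1\in S_1\setminus S_2$, $v_2\in S_2\setminus S_1$ with $S_1\setminus\{v_1\}=S_2\setminus\{v_2\}$; $\mathcal{TS}_-(G)$ has the same vertices, with $S_1S_2$ an edge iff additionally $v_1v_2\in E(G)$. -}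

module Defs where

open import Data.Nat using (ℕ; suc; _≤_)
open import Data.Fin using (Fin; toℕ)
open import Data.Fin.Subset using (Subset; _∈_; _∉_; _-_; ∣_∣)
open import Data.Product using (Σ; ∃; _×_)
open import Relation.Binary.PropositionalEquality using (_≡_; _≢_)
open import Relation.Nullary using (¬_)
open import Function.Bundles using (_⇔_)
open import Function.Definitions using (Injective)

Graph : ℕ → Set₁
Graph n = Fin n → Fin n → Set

P : (n : ℕ) → Graph n
P n i j = (suc (toℕ i) ≡ toℕ j) ⊎' (suc (toℕ j) ≡ toℕ i)
  where
  open import Data.Sum using () renaming (_⊎_ to _⊎'_)

-- Skew forcing closure: `Forced G B w` means w eventually becomes blue
-- starting from the blue set B.  Either w is initially blue, or some vertex
-- u (blue or white) adjacent to w has all its neighbours other than w already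
-- (eventually) blue, i.e. w is its unique white neighbour and gets forced.
data Forced {n : ℕ} (G : Graph n) (B : Subset n) : Fin n → Set where
  initial : ∀ {w} → w ∈ B → Forced G B w
  force   : ∀ {w} (u : Fin n) → G u w →
            (∀ x → G u x → x ≢ w → Forced G B x) → Forced G B w

IsSkewForcingSet : ∀ {n} → Graph n → Subset n → Set
IsSkewForcingSet G B = ∀ v → Forced G B v

IsMinSkewForcingSet : ∀ {n} → Graph n → Subset n → Set
IsMinSkewForcingSet G S =
  IsSkewForcingSet G S × (∀ B → IsSkewForcingSet G B → ∣ S ∣ ≤ ∣ B ∣)

TEedge : ∀ {n} → Graph n → Subset n → Subset n → Set
TEedge {n} G S₁ S₂ = Σ (Fin n) λ v₁ → Σ (Fin n) λ v₂ →
  v₁ ∈ S₁ × v₁ ∉ S₂ × v₂ ∈ S₂ × v₂ ∉ S₁ × (S₁ - v₁ ≡ S₂ - v₂)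

TSedge : ∀ {n} → Graph n → Subset n → Subset n → Set
TSedge {n} G S₁ S₂ = Σ (Fin n) λ v₁ → Σ (Fin n) λ v₂ →
  v₁ ∈ S₁ × v₁ ∉ S₂ × v₂ ∈ S₂ × v₂ ∉ S₁ × (S₁ - v₁ ≡ S₂ - v₂) × G v₁ v₂

-- The reconfiguration graph with vertex set {S | IsMinSkewForcingSet G S}
-- and edge relation E is isomorphic to the graph on Fin m with adjacency R:
-- there is a bijection f from Fin m onto the minimum skew forcing sets
-- preserving and reflecting adjacency.
IsoTo : ∀ {n} (G : Graph n) (E : Subset n → Subset n → Set)
        (m : ℕ) (R : Fin m → Fin m → Set) → Set
IsoTo {n} G E m R = Σ (Fin m → Subset n) λ f →
  (∀ i → IsMinSkewForcingSet G (f i)) ×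
  Injective _≡_ _≡_ f ×
  (∀ S → IsMinSkewForcingSet G S → ∃ λ i → f i ≡ S) ×
  (∀ i j → E (f i) (f j) ⇔ R i j)

Kadj : (m : ℕ) → Fin m → Fin m → Set
Kadj m i j = i ≢ j

Emptyadj : (m : ℕ) → Fin m → Fin m → Set
Emptyadj m i j = ⊥'
  where open import Data.Empty using () renaming (⊥ to ⊥')

-- Equality of the two reconfiguration graphs (same vertex set by
-- construction, same edges).
SameEdges : ∀ {n} (G : Graph n) (E₁ E₂ : Subset n → Subset n → Set) → Set
SameEdges G E₁ E₂ = ∀ S₁ S₂ → IsMinSkewForcingSet G S₁ → IsMinSkewForcingSet G S₂ →
  E₁ S₁ S₂ ⇔ E₂ S₁ S₂

-- In P_n every odd position 2r+1 is forced from any start, by position 2r, whose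
-- other neighbour is already blue.  A blue even position propagates to all even
-- positions, each forced by the odd vertex beside it.  For even n the last
-- vertex n-1 is odd and forces n-2, so the empty set is a skew forcing set.
-- For odd n every odd vertex has two even neighbours, so no forcing step turns an
-- even vertex blue unless one already is; hence the minimum skew forcing sets are
-- exactly the singletons {2i}.  Distinct singletons are exchange-adjacent, but
-- even positions are never adjacent in the path, so no token can slide.
module Submission where

open import Defs
open import Data.Nat using (ℕ; zero; suc; _*_; _≤_; _<_; _≤′_; ≤′-refl; ≤′-step; z≤n; s≤s)
open import Data.Nat.Properties
open import Data.Fin using (Fin; toℕ; fromℕ<) renaming (zero to fzero; suc to fsuc)
open import Data.Fin.Properties using (toℕ-injective; toℕ-fromℕ<; toℕ<n)
open import Data.Fin.Subset using (Subset; _∈_; _-_; ∣_∣; ⁅_⁆; ⊥; inside; outside)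
open import Data.Fin.Subset.Properties using (∉⊥; ∣⊥∣≡0; x∈⁅x⁆; x∈⁅y⁆⇒x≡y; ∣⁅x⁆∣≡1; x∈p⇒∣p-x∣<∣p∣)
open import Data.Vec using ([]; _∷_)
open import Data.Product using (∃; _×_; _,_; proj₁)
open import Data.Sum using (_⊎_; inj₁; inj₂)
open import Data.Empty using (⊥-elim)
open import Relation.Binary.PropositionalEquality using (_≡_; _≢_; refl; sym; trans; cong; subst; subst₂; ≢-sym)
open import Relation.Nullary using (¬_)
open import Function using (_∘_)
open import Function.Bundles using (_⇔_; mk⇔; Equivalence)

Even Odd : ℕ → Set
Even m = ∃ λ q → m ≡ 2 * q
Odd m = ∃ λ q → m ≡ suc (2 * q)

even-or-odd : ∀ m → Even m ⊎ Odd m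
even-or-odd zero = inj₁ (0 , refl)
even-or-odd (suc m) with even-or-odd m
... | inj₁ (q , m≡2q) = inj₂ (q , cong suc m≡2q)
... | inj₂ (q , m≡1+2q) = inj₁ (suc q , trans (cong suc m≡1+2q) (sym (*-suc 2 q)))

even⇒¬odd : ∀ {m} → Even m → ¬ Odd m
even⇒¬odd (q , m≡2q) (r , m≡1+2r) = even≢odd q r (trans (sym m≡2q) m≡1+2r)

∣p∣≡0⇒p≡⊥ : ∀ {n} (p : Subset n) → ∣ p ∣ ≡ 0 → p ≡ ⊥
∣p∣≡0⇒p≡⊥ [] _ = refl
∣p∣≡0⇒p≡⊥ (outside ∷ p) ∣p∣≡0 = cong (outside ∷_) (∣p∣≡0⇒p≡⊥ p ∣p∣≡0)

∣p∣≡1⇒p≡⁅x⁆ : ∀ {n} (p : Subset n) → ∣ p ∣ ≡ 1 → ∃ λ x → p ≡ ⁅ x ⁆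
∣p∣≡1⇒p≡⁅x⁆ (inside ∷ p) ∣p∣≡1 = fzero , cong (inside ∷_) (∣p∣≡0⇒p≡⊥ p (suc-injective ∣p∣≡1))
∣p∣≡1⇒p≡⁅x⁆ (outside ∷ p) ∣p∣≡1 with ∣p∣≡1⇒p≡⁅x⁆ p ∣p∣≡1
... | x , p≡⁅x⁆ = fsuc x , cong (outside ∷_) p≡⁅x⁆

⁅x⁆-x≡⊥ : ∀ {n} (x : Fin n) → ⁅ x ⁆ - x ≡ ⊥
⁅x⁆-x≡⊥ x = ∣p∣≡0⇒p≡⊥ (⁅ x ⁆ - x) (n<1⇒n≡0 (subst (∣ ⁅ x ⁆ - x ∣ <_) (∣⁅x⁆∣≡1 x) (x∈p⇒∣p-x∣<∣p∣ (x∈⁅x⁆ x))))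

module _ {n : ℕ} {G : Graph n} where

  ⊥-minimum : IsSkewForcingSet G ⊥ → IsMinSkewForcingSet G ⊥
  ⊥-minimum ⊥-forces = ⊥-forces , λ B _ → subst (_≤ ∣ B ∣) (sym (∣⊥∣≡0 n)) z≤n

  minimum≡⊥ : IsSkewForcingSet G ⊥ → ∀ {S} → IsMinSkewForcingSet G S → S ≡ ⊥
  minimum≡⊥ ⊥-forces {S} (_ , minimal) =
    ∣p∣≡0⇒p≡⊥ S (n≤0⇒n≡0 (subst (∣ S ∣ ≤_) (∣⊥∣≡0 n) (minimal ⊥ ⊥-forces)))

  forcing-nonempty : ¬ IsSkewForcingSet G ⊥ → ∀ {B} → IsSkewForcingSet G B → 1 ≤ ∣ B ∣
  forcing-nonempty ⊥-fails {B} B-forces with ∣ B ∣ in ∣B∣≡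
  ... | suc _ = s≤s z≤n
  ... | zero = ⊥-elim (⊥-fails (subst (IsSkewForcingSet G) (∣p∣≡0⇒p≡⊥ B ∣B∣≡) B-forces))

  singleton-minimum : ¬ IsSkewForcingSet G ⊥ → ∀ v → IsSkewForcingSet G ⁅ v ⁆ →
                      IsMinSkewForcingSet G ⁅ v ⁆
  singleton-minimum ⊥-fails v v-forces =
    v-forces , λ B B-forces → subst (_≤ ∣ B ∣) (sym (∣⁅x⁆∣≡1 v)) (forcing-nonempty ⊥-fails B-forces)

  minimum-singleton : ¬ IsSkewForcingSet G ⊥ → ∀ v → IsSkewForcingSet G ⁅ v ⁆ →
                      ∀ {S} → IsMinSkewForcingSet G S → ∃ λ x → S ≡ ⁅ x ⁆
  minimum-singleton ⊥-fails v v-forces {S} (S-forces , minimal) = ∣p∣≡1⇒p≡⁅x⁆ S ∣S∣≡1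
    where
    ∣S∣≡1 : ∣ S ∣ ≡ 1
    ∣S∣≡1 = ≤-antisym (subst (∣ S ∣ ≤_) (∣⁅x⁆∣≡1 v) (minimal ⁅ v ⁆ v-forces))
                      (forcing-nonempty ⊥-fails S-forces)

  ¬TEedge-⊥ : ∀ {S} → ¬ TEedge G ⊥ S
  ¬TEedge-⊥ (_ , _ , v₁∈⊥ , _) = ∉⊥ v₁∈⊥

  TSedge⇒TEedge : ∀ {S₁ S₂} → TSedge G S₁ S₂ → TEedge G S₁ S₂
  TSedge⇒TEedge (v₁ , v₂ , v₁∈S₁ , v₁∉S₂ , v₂∈S₂ , v₂∉S₁ , S₁-v₁≡S₂-v₂ , _) =
    v₁ , v₂ , v₁∈S₁ , v₁∉S₂ , v₂∈S₂ , v₂∉S₁ , S₁-v₁≡S₂-v₂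

  TEedge-⁅⁆⇔≢ : ∀ a b → TEedge G ⁅ a ⁆ ⁅ b ⁆ ⇔ a ≢ b
  TEedge-⁅⁆⇔≢ a b = mk⇔ to from
    where
    to : TEedge G ⁅ a ⁆ ⁅ b ⁆ → a ≢ b
    to (_ , _ , v₁∈⁅a⁆ , v₁∉⁅b⁆ , _) refl = v₁∉⁅b⁆ v₁∈⁅a⁆
    from : a ≢ b → TEedge G ⁅ a ⁆ ⁅ b ⁆
    from a≢b = a , b , x∈⁅x⁆ a , a≢b ∘ x∈⁅y⁆⇒x≡y b , x∈⁅x⁆ b , a≢b ∘ sym ∘ x∈⁅y⁆⇒x≡y a ,
               trans (⁅x⁆-x≡⊥ a) (sym (⁅x⁆-x≡⊥ b))

  TSedge-⁅⁆⇒adjacent : ∀ {a b} → TSedge G ⁅ a ⁆ ⁅ b ⁆ → G a b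
  TSedge-⁅⁆⇒adjacent {a} {b} (v₁ , v₂ , v₁∈⁅a⁆ , _ , v₂∈⁅b⁆ , _ , _ , v₁~v₂) =
    subst₂ G (x∈⁅y⁆⇒x≡y a v₁∈⁅a⁆) (x∈⁅y⁆⇒x≡y b v₂∈⁅b⁆) v₁~v₂

  ⊥-forcing⇒TE≡TS : IsSkewForcingSet G ⊥ → SameEdges G (TEedge G) (TSedge G)
  ⊥-forcing⇒TE≡TS ⊥-forces S₁ S₂ S₁-min _ = mk⇔ no-edge TSedge⇒TEedge
    where
    no-edge : TEedge G S₁ S₂ → TSedge G S₁ S₂
    no-edge = ⊥-elim ∘ ¬TEedge-⊥ ∘ subst (λ S → TEedge G S S₂) (minimum≡⊥ ⊥-forces S₁-min)

  ⊥-forcing⇒TE≅K₁ : IsSkewForcingSet G ⊥ → IsoTo G (TEedge G) 1 (Kadj 1)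
  ⊥-forcing⇒TE≅K₁ ⊥-forces =
    (λ _ → ⊥) , (λ _ → ⊥-minimum ⊥-forces) , injective ,
    (λ S S-min → fzero , sym (minimum≡⊥ ⊥-forces S-min)) , edges
    where
    injective : ∀ {i j : Fin 1} → ⊥ ≡ ⊥ → i ≡ j
    injective {fzero} {fzero} _ = refl
    edges : ∀ i j → TEedge G ⊥ ⊥ ⇔ Kadj 1 i j
    edges fzero fzero = mk⇔ (⊥-elim ∘ ¬TEedge-⊥) (λ 0≢0 → ⊥-elim (0≢0 refl))

module PathForcing {n : ℕ} (B : Subset n) where

  -- vacuous for m ≥ n
  Blue : ℕ → Set
  Blue m = ∀ w → toℕ w ≡ m → Forced (P n) B w

  -- u at position m forces m+1 once its left neighbour (if any) is blue
  blue-rightward : ∀ m → (∀ x → suc (toℕ x) ≡ m → Forced (P n) B x) → Blue (suc m)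
  blue-rightward m left w w≡1+m = force u (inj₁ u→w) others
    where
    m<n : m < n
    m<n = subst (_≤ n) w≡1+m (<⇒≤ (toℕ<n w))
    u = fromℕ< m<n
    u→w : suc (toℕ u) ≡ toℕ w
    u→w = trans (cong suc (toℕ-fromℕ< m<n)) (sym w≡1+m)
    others : ∀ x → P n u x → x ≢ w → Forced (P n) B x
    others x (inj₁ u→x) x≢w = ⊥-elim (x≢w (toℕ-injective (trans (sym u→x) u→w)))
    others x (inj₂ x→u) _ = left x (trans x→u (toℕ-fromℕ< m<n))

  -- u at position m+1 forces m once m+2 (if present) is blue
  blue-leftward : ∀ {m} → suc m < n → Blue (suc (suc m)) → Blue m
  blue-leftward {m} 1+m<n right w w≡m = force u (inj₂ w→u) others
    where
    u = fromℕ< 1+m<n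
    w→u : suc (toℕ w) ≡ toℕ u
    w→u = trans (cong suc w≡m) (sym (toℕ-fromℕ< 1+m<n))
    others : ∀ x → P n u x → x ≢ w → Forced (P n) B x
    others x (inj₁ u→x) _ = right x (trans (sym u→x) (cong suc (toℕ-fromℕ< 1+m<n)))
    others x (inj₂ x→u) x≢w = ⊥-elim (x≢w (toℕ-injective (suc-injective (trans x→u (sym w→u)))))

  blue-2+ : ∀ {m} → Blue m → Blue (suc (suc m))
  blue-2+ {m} blue = blue-rightward (suc m) (λ x 1+x≡1+m → blue x (suc-injective 1+x≡1+m))

  blue-odd : ∀ q → Blue (suc (2 * q))
  blue-odd zero = blue-rightward 0 (λ _ ())
  blue-odd (suc q) = subst (Blue ∘ suc) (sym (*-suc 2 q)) (blue-2+ (blue-odd q))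

  blue-even-up : ∀ {i q} → i ≤′ q → Blue (2 * i) → Blue (2 * q)
  blue-even-up ≤′-refl blue = blue
  blue-even-up (≤′-step {q} i≤′q) blue = subst Blue (sym (*-suc 2 q)) (blue-2+ (blue-even-up i≤′q blue))

  blue-even-down : ∀ {q i} → q ≤′ i → 2 * i ≤ n → Blue (2 * i) → Blue (2 * q)
  blue-even-down ≤′-refl _ blue = blue
  blue-even-down (≤′-step {i} q≤′i) 2[1+i]≤n blue =
    blue-even-down q≤′i (≤-trans (m≤n+m (2 * i) 2) 2+2i≤n)
      (blue-leftward 2+2i≤n (subst Blue (*-suc 2 i) blue))
    where
    2+2i≤n : suc (suc (2 * i)) ≤ n
    2+2i≤n = subst (_≤ n) (*-suc 2 i) 2[1+i]≤n

  skewForcing-if-evens-blue : (∀ q → 2 * q < n → Blue (2 * q)) → IsSkewForcingSet (P n) B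
  skewForcing-if-evens-blue evens w with even-or-odd (toℕ w)
  ... | inj₁ (q , w≡2q) = evens q (subst (_< n) w≡2q (toℕ<n w)) w w≡2q
  ... | inj₂ (q , w≡1+2q) = blue-odd q w w≡1+2q

open PathForcing using (Blue; blue-even-up; blue-even-down; skewForcing-if-evens-blue)

evenPath-skewForcing-⊥ : ∀ k → IsSkewForcingSet (P (2 * k)) ⊥
evenPath-skewForcing-⊥ k = skewForcing-if-evens-blue ⊥ λ q 2q<2k →
  blue-even-down ⊥ (≤⇒≤′ (<⇒≤ (*-cancelˡ-< 2 q k 2q<2k))) ≤-refl last-vacuous
  where
  last-vacuous : Blue ⊥ (2 * k)
  last-vacuous w w≡2k = ⊥-elim (<-irrefl w≡2k (toℕ<n w))

singleton-even-skewForcing : ∀ {n} (v : Fin n) → Even (toℕ v) → IsSkewForcingSet (P n) ⁅ v ⁆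
singleton-even-skewForcing {n} v (i , v≡2i) = skewForcing-if-evens-blue ⁅ v ⁆ λ q _ → from-v q
  where
  v-blue : Blue ⁅ v ⁆ (2 * i)
  v-blue w w≡2i = initial (subst (_∈ ⁅ v ⁆) (toℕ-injective (trans v≡2i (sym w≡2i))) (x∈⁅x⁆ v))
  from-v : ∀ q → Blue ⁅ v ⁆ (2 * q)
  from-v q with ≤-total i q
  ... | inj₁ i≤q = blue-even-up ⁅ v ⁆ (≤⇒≤′ i≤q) v-blue
  ... | inj₂ q≤i = blue-even-down ⁅ v ⁆ (≤⇒≤′ q≤i) (subst (_≤ n) v≡2i (<⇒≤ (toℕ<n v))) v-blue

adjacent-not-both-even : ∀ {n} {u v : Fin n} → P n u v → Even (toℕ u) → ¬ Even (toℕ v)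
adjacent-not-both-even (inj₁ u→v) (q , u≡2q) v-even =
  even⇒¬odd v-even (q , trans (sym u→v) (cong suc u≡2q))
adjacent-not-both-even (inj₂ v→u) u-even (r , v≡2r) =
  even⇒¬odd u-even (r , trans (sym v→u) (cong suc v≡2r))

two-apart⇒≢ : ∀ {n} {x y : Fin n} → toℕ y ≡ suc (suc (toℕ x)) → x ≢ y
two-apart⇒≢ {x = x} y≡2+x x≡y = m≢1+n+m (toℕ x) {1} (trans (cong toℕ x≡y) y≡2+x)

module OddPath (k : ℕ) where

  n : ℕ
  n = suc (2 * k)

  -- Since n is odd, a vertex next to an even vertex is odd and thus not an endpoint.
  another-even-neighbour : ∀ {u w : Fin n} → P n u w → Even (toℕ w) →
                           ∃ λ x → P n u x × x ≢ w × Even (toℕ x)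
  another-even-neighbour {u} {w} (inj₂ w→u) (q , w≡2q) =
    x , inj₁ u→x , ≢-sym (two-apart⇒≢ (trans x≡2[1+q] 2[1+q]≡2+w)) , (suc q , x≡2[1+q])
    where
    2q<2k : 2 * q < 2 * k
    2q<2k = ≤-pred (subst (λ m → suc m ≤ n) (trans (sym w→u) (cong suc w≡2q)) (toℕ<n u))
    x<n : 2 * suc q < n
    x<n = s≤s (*-monoʳ-≤ 2 (*-cancelˡ-< 2 q k 2q<2k))
    x = fromℕ< x<n
    x≡2[1+q] : toℕ x ≡ 2 * suc q
    x≡2[1+q] = toℕ-fromℕ< x<n
    2[1+q]≡2+w : 2 * suc q ≡ suc (suc (toℕ w))
    2[1+q]≡2+w = trans (*-suc 2 q) (cong (suc ∘ suc) (sym w≡2q))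
    u→x : suc (toℕ u) ≡ toℕ x
    u→x = trans (cong suc (sym w→u)) (sym (trans x≡2[1+q] 2[1+q]≡2+w))
  another-even-neighbour (inj₁ u→w) (zero , w≡0) = ⊥-elim (0≢1+n (trans (sym w≡0) (sym u→w)))
  another-even-neighbour {u} {w} (inj₁ u→w) (suc q , w≡2[1+q]) =
    x , inj₂ x→u , two-apart⇒≢ w≡2+x , (q , x≡2q)
    where
    u≡1+2q : toℕ u ≡ suc (2 * q)
    u≡1+2q = suc-injective (trans u→w (trans w≡2[1+q] (*-suc 2 q)))
    x<n : 2 * q < n
    x<n = <-trans (n<1+n (2 * q)) (subst (_< n) u≡1+2q (toℕ<n u))
    x = fromℕ< x<n
    x≡2q : toℕ x ≡ 2 * q
    x≡2q = toℕ-fromℕ< x<n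
    x→u : suc (toℕ x) ≡ toℕ u
    x→u = trans (cong suc x≡2q) (sym u≡1+2q)
    w≡2+x : toℕ w ≡ suc (suc (toℕ x))
    w≡2+x = trans (sym u→w) (cong suc (sym x→u))

  forced-odd : ∀ {B} → (∀ {x} → x ∈ B → Odd (toℕ x)) → ∀ {w} → Forced (P n) B w → Odd (toℕ w)
  forced-odd B-odd (initial w∈B) = B-odd w∈B
  forced-odd B-odd {w} (force u u~w others) with even-or-odd (toℕ w)
  ... | inj₂ w-odd = w-odd
  ... | inj₁ w-even with another-even-neighbour u~w w-even
  ...   | x , u~x , x≢w , x-even = ⊥-elim (even⇒¬odd x-even (forced-odd B-odd (others x u~x x≢w)))

  odd-set-not-forcing : ∀ {B} → (∀ {x} → x ∈ B → Odd (toℕ x)) → ¬ IsSkewForcingSet (P n) B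
  odd-set-not-forcing B-odd B-forces with forced-odd B-odd (B-forces fzero)
  ... | _ , ()

  ⊥-not-forcing : ¬ IsSkewForcingSet (P n) ⊥
  ⊥-not-forcing = odd-set-not-forcing (⊥-elim ∘ ∉⊥)

  2i<n : ∀ (i : Fin (suc k)) → 2 * toℕ i < n
  2i<n i = s≤s (*-monoʳ-≤ 2 (≤-pred (toℕ<n i)))

  even-vertex : Fin (suc k) → Fin n
  even-vertex i = fromℕ< (2i<n i)

  toℕ-even-vertex : ∀ i → toℕ (even-vertex i) ≡ 2 * toℕ i
  toℕ-even-vertex i = toℕ-fromℕ< (2i<n i)

  even-vertex-even : ∀ i → Even (toℕ (even-vertex i))
  even-vertex-even i = toℕ i , toℕ-even-vertex i

  even-vertex-injective : ∀ {i j} → even-vertex i ≡ even-vertex j → i ≡ j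
  even-vertex-injective {i} {j} eq = toℕ-injective (*-cancelˡ-≡ (toℕ i) (toℕ j) 2
    (trans (sym (toℕ-even-vertex i)) (trans (cong toℕ eq) (toℕ-even-vertex j))))

  even-vertex-surjective : ∀ {v} → Even (toℕ v) → ∃ λ i → even-vertex i ≡ v
  even-vertex-surjective {v} (q , v≡2q) = i , toℕ-injective (trans (toℕ-even-vertex i) 2i≡v)
    where
    q≤k : q ≤ k
    q≤k = *-cancelˡ-≤ 2 (≤-pred (subst (λ m → suc m ≤ n) v≡2q (toℕ<n v)))
    i : Fin (suc k)
    i = fromℕ< (s≤s q≤k)
    2i≡v : 2 * toℕ i ≡ toℕ v
    2i≡v = trans (cong (2 *_) (toℕ-fromℕ< (s≤s q≤k))) (sym v≡2q)

  even-singleton : Fin (suc k) → Subset n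
  even-singleton i = ⁅ even-vertex i ⁆

  even-singleton-minimum : ∀ i → IsMinSkewForcingSet (P n) (even-singleton i)
  even-singleton-minimum i =
    singleton-minimum ⊥-not-forcing (even-vertex i)
      (singleton-even-skewForcing (even-vertex i) (even-vertex-even i))

  even-singleton-injective : ∀ {i j} → even-singleton i ≡ even-singleton j → i ≡ j
  even-singleton-injective {i} {j} eq =
    even-vertex-injective (x∈⁅y⁆⇒x≡y (even-vertex j) (subst (even-vertex i ∈_) eq (x∈⁅x⁆ (even-vertex i))))

  minimum≡even-singleton : ∀ S → IsMinSkewForcingSet (P n) S → ∃ λ i → even-singleton i ≡ S
  minimum≡even-singleton S S-min@(S-forces , _)
    with minimum-singleton ⊥-not-forcing (even-vertex fzero) (proj₁ (even-singleton-minimum fzero)) S-min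
  ... | v , S≡⁅v⁆ with even-or-odd (toℕ v)
  ...   | inj₁ v-even = let (i , i↦v) = even-vertex-surjective v-even in
                        i , trans (cong ⁅_⁆ i↦v) (sym S≡⁅v⁆)
  ...   | inj₂ v-odd =
    ⊥-elim (odd-set-not-forcing ⁅v⁆-odd (subst (IsSkewForcingSet (P n)) S≡⁅v⁆ S-forces))
    where
    ⁅v⁆-odd : ∀ {x} → x ∈ ⁅ v ⁆ → Odd (toℕ x)
    ⁅v⁆-odd x∈⁅v⁆ = subst (Odd ∘ toℕ) (sym (x∈⁅y⁆⇒x≡y v x∈⁅v⁆)) v-odd

  TE≅K : IsoTo (P n) (TEedge (P n)) (suc k) (Kadj (suc k))
  TE≅K = even-singleton , even-singleton-minimum , even-singleton-injective , minimum≡even-singleton ,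
    λ i j → let open Equivalence (TEedge-⁅⁆⇔≢ {G = P n} (even-vertex i) (even-vertex j)) in
      mk⇔ (λ e i≡j → to e (cong even-vertex i≡j)) (λ i≢j → from (i≢j ∘ even-vertex-injective))

  TS≅empty : IsoTo (P n) (TSedge (P n)) (suc k) (Emptyadj (suc k))
  TS≅empty = even-singleton , even-singleton-minimum , even-singleton-injective , minimum≡even-singleton ,
    λ i j → mk⇔ (λ e → adjacent-not-both-even (TSedge-⁅⁆⇒adjacent e)
                         (even-vertex-even i) (even-vertex-even j))
                (λ ())

mainTheorem13 :
  (∀ k → SameEdges (P (2 * k)) (TEedge (P (2 * k))) (TSedge (P (2 * k)))
           × IsoTo (P (2 * k)) (TEedge (P (2 * k))) 1 (Kadj 1))
  × (∀ k → IsoTo (P (suc (2 * k))) (TEedge (P (suc (2 * k)))) (suc k) (Kadj (suc k))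
           × IsoTo (P (suc (2 * k))) (TSedge (P (suc (2 * k)))) (suc k) (Emptyadj (suc k)))
mainTheorem13 =
  (λ k → ⊥-forcing⇒TE≡TS (evenPath-skewForcing-⊥ k) , ⊥-forcing⇒TE≅K₁ (evenPath-skewForcing-⊥ k)) ,
  (λ k → OddPath.TE≅K k , OddPath.TS≅empty k)
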